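{- Let $\kappa\ge1$, $p\ge1$, $\gamma\ge1$ and $D$ be integers with $D/(p+1)$ an integer and $D/(p+1)\le 2^p$. Over the alphabet $\{0,1,\#\}$, let $S$ be the set of all standard $\kappa$-gapped patterns $p_1\{0,\gamma\}p_2\cdots\{0,\gamma\}p_{\kappa+1}$ in which each subpattern $p_i$ is a binary string of length $p$, the subpatterns are pairwise distinct, and $p_1,\dots,p_{\kappa+1}$ are in increasing lexicographic order. Let $Q$ be the set of all texts of the form $\#w_1\#w_2\cdots\#w_{D/(p+1)}$ where the $w_j$ are pairwise distinct binary strings of length $p$ in increasing lexicographic order. Then for any $\beta$ distinct patterns $P_1,\dots,P_\beta\in S$, at most $\binom{2^p-\beta^{1/(\kappa+1)}}{D/(p+1)-\beta^{1/(\kappa+1)}}$ texts in $Q$ match all of $P_1,\dots,P_\beta$.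
   Context: A standard $\kappa$-gapped pattern $p_1\{0,\gamma\}p_2\{0,\gamma\}\cdots\{0,\gamma\}p_{\kappa+1}$ (with strings $p_i$, called subpatterns, and integer $\gamma$) matches a text if one can find an occurrence of every $p_i$ in the text such that, for each $1\le i\le\kappa$, there are between $0$ and $\gamma$ characters between the occurrence of $p_i$ and the occurrence of $p_{i+1}$. -}

module Defs where

open import Data.Nat using (ℕ; zero; suc; _+_; _*_; _≤_; _<_)
open import Data.Bool using (Bool; true; false)
open import Data.List using (List; []; _∷_; length; take; drop; map; concatMap)
open import Data.Vec using (Vec; lookup; toList)
open import Data.Fin using (Fin; inject₁)
open import Data.Product using (Σ; _×_; ∃)
open import Relation.Binary.PropositionalEquality using (_≡_)

data Sym : Set where
  𝟎 𝟏 ♯ : Sym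

bit : Bool → Sym
bit false = 𝟎
bit true  = 𝟏

word : ∀ {p} → Vec Bool p → List Sym
word v = map bit (toList v)

data LexLt : ∀ {n} → Vec Bool n → Vec Bool n → Set where
  here : ∀ {n} {xs ys : Vec Bool n} → LexLt (false Vec.∷ xs) (true Vec.∷ ys)
  there : ∀ {n} {b} {xs ys : Vec Bool n} → LexLt xs ys → LexLt (b Vec.∷ xs) (b Vec.∷ ys)

-- strictly increasing lexicographic order (hence pairwise distinct)
Increasing : ∀ {p k} → Vec (Vec Bool p) k → Set
Increasing {k = zero} v = Data.Unit.⊤
  where import Data.Unit
Increasing {k = suc k} v = (i : Fin k) → LexLt (lookup v (inject₁ i)) (lookup v (Fin.suc i))
  where import Data.Fin as Fin

OccursAt : List Sym → List Sym → ℕ → Set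
OccursAt w t s = (s + length w ≤ length t) × (take (length w) (drop s t) ≡ w)

-- standard κ-gapped pattern p₁{0,γ}p₂…{0,γ}p_{κ+1}, given by its κ+1 subpatterns and γ:
-- there are occurrence positions pos i of every subpattern such that between the
-- end of the occurrence of pᵢ and the start of that of pᵢ₊₁ there are 0..γ characters.
Matches : ∀ {κ} → ℕ → Vec (List Sym) (suc κ) → List Sym → Set
Matches {κ} γ ps t =
  Σ (Fin (suc κ) → ℕ) λ pos →
    ((i : Fin (suc κ)) → OccursAt (lookup ps i) t (pos i)) ×
    ((i : Fin κ) →
      (pos (inject₁ i) + length (lookup ps (inject₁ i)) ≤ pos (Fin.suc i)) ×
      (pos (Fin.suc i) ≤ pos (inject₁ i) + length (lookup ps (inject₁ i)) + γ))
  where import Data.Fin as Fin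

-- binary-subpattern pattern (element of S when Increasing holds)
BinPattern : ℕ → ℕ → Set
BinPattern κ p = Vec (Vec Bool p) (suc κ)

MatchesBin : ∀ {κ p} → ℕ → BinPattern κ p → List Sym → Set
MatchesBin γ P t = Matches γ (Data.Vec.map word P) t

encode : ∀ {p m} → Vec (Vec Bool p) m → List Sym
encode ws = concatMap (λ w → ♯ ∷ word w) (toList ws)

-- membership in Q (with m = D/(p+1) words)
InQ : ℕ → ℕ → List Sym → Set
InQ p m t = Σ (Vec (Vec Bool p) m) λ ws → Increasing ws × (t ≡ encode ws)

-- Let U be the list of binary words occurring as subpatterns of P₁, …, P_β, and k its length.
-- The Pⱼ are distinct (κ+1)-tuples over U, so β ≤ k^(κ+1), and the minimality of t gives t ≤ k.
-- A text #w₁#w₂…#w_m in Q is determined by its sorted word list, and every #-free window of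
-- length p ≥ 1 in it is one of the wᵢ; so a text matching all patterns contains every word of U.
-- Hence the texts give distinct m-element sublists of the 2^p binary words that contain U, and
-- there are at most C(2^p − k, m − k) ≤ C(2^p − t, m − t) of those.

module Submission where

open import Defs
open import Data.Bool using (Bool; true; false) renaming (_≟_ to _≟ᵇ_)
open import Data.Empty using (⊥-elim)
open import Data.Fin as Fin using (Fin; funToFin; finToFun)
open import Data.Fin.Properties using (injective⇒≤; finToFun-funToFin; any?)
import Data.List as List
open import Data.List using (List; []; _∷_; _++_; length; map; take; drop; filter; concatMap)
open import Data.List.Properties using (length-++; length-map; length-take; length-drop; ++-identityʳ; ∷-injective; ∷-injectiveˡ)
open import Data.List.Membership.Propositional using (_∈_; _∉_)
open import Data.List.Membership.Propositional.Properties using (∈-map⁺; ∈-map⁻; ∈-++⁺ˡ; ∈-++⁺ʳ; ∈-filter⁺; ∈-filter⁻)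
open import Data.List.Relation.Unary.All as All using (All; []; _∷_)
open import Data.List.Relation.Unary.AllPairs as AllPairs using (AllPairs; []; _∷_)
import Data.List.Relation.Unary.AllPairs.Properties as AllPairs
import Data.List.Relation.Unary.All.Properties as All
open import Data.List.Relation.Unary.Any using (here; there; index)
open import Data.List.Relation.Unary.Any.Properties using (lookup-index)
open import Data.List.Relation.Unary.Unique.Propositional using (Unique)
import Data.List.Relation.Unary.Unique.Propositional.Properties as Unique
open import Data.List.Relation.Unary.Linked using (Linked; []; [-]; _∷_)
open import Data.List.Relation.Unary.Linked.Properties using (Linked⇒AllPairs)
open import Data.List.Relation.Binary.Sublist.Propositional using (_⊆_; []; _∷_; _∷ʳ_; ⊆-trans)
open import Data.List.Relation.Binary.Sublist.Propositional.Properties using ([]⊆-universal; ∷⁻; length-mono-≤; Any-resp-⊆; filter-⊆)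
open import Data.Nat using (ℕ; zero; suc; _+_; _*_; _^_; _∸_; _≤_; _<_; _⊓_; z≤n; s≤s; _≤?_; z<s)
open import Data.Nat.Properties
  using ( suc-injective; +-suc; +-identityʳ; +-∸-comm; m+[n∸m]≡n; m≤n⇒∃[o]m+o≡n
        ; ≤-refl; ≤-reflexive; ≤-trans; ≤-pred; m≤n⇒m≤1+n; m≤m+n; m<n+m; m⊓n≤n; m∸n≤m
        ; 1+n≰n; ≰⇒>; ≮⇒≥; <⇒≱; +-monoˡ-≤; +-monoʳ-≤; module ≤-Reasoning )
open import Data.Nat.Combinatorics using (_C_; nCk+nC[k+1]≡[n+1]C[k+1])
open import Data.Product using (_×_; _,_; proj₁; proj₂; ∃; ∃₂)
open import Data.Vec as Vec using (Vec)
open import Data.Vec.Properties using (length-toList; lookup-map; ≡-dec)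
open import Data.Vec.Relation.Binary.Pointwise.Extensional using (ext; Pointwise-≡⇒≡)
open import Relation.Binary.PropositionalEquality
  using (_≡_; _≢_; refl; sym; trans; cong; cong₂; subst; module ≡-Reasoning)
open import Relation.Nullary using (¬_; Dec; yes; no)
open import Function using (_∘_)
open import Function.Definitions using (Injective)

take-length-++ : ∀ {A : Set} (xs ys : List A) → take (length xs) (xs ++ ys) ≡ xs
take-length-++ []       ys = refl
take-length-++ (x ∷ xs) ys = cong (x ∷_) (take-length-++ xs ys)

drop-length-++ : ∀ {A : Set} (xs ys : List A) k → drop (length xs + k) (xs ++ ys) ≡ drop k ys
drop-length-++ []       ys k = refl
drop-length-++ (x ∷ xs) ys k = drop-length-++ xs ys k

length-window : ∀ {A : Set} (xs : List A) s k → length (take k (drop s xs)) ≤ length xs ∸ s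
length-window xs s k = begin
  length (take k (drop s xs)) ≡⟨ length-take k (drop s xs) ⟩
  k ⊓ length (drop s xs)      ≤⟨ m⊓n≤n k _ ⟩
  length (drop s xs)          ≡⟨ length-drop s xs ⟩
  length xs ∸ s               ∎
  where open ≤-Reasoning

♯∈window : ∀ xs ys {s k} → s ≤ length xs → length xs < s + k → ♯ ∈ take k (drop s (xs ++ ♯ ∷ ys))
♯∈window []       ys {zero}  {suc k} _         _            = here refl
♯∈window (x ∷ xs) ys {zero}  {suc k} _         (s≤s xs<k)   = there (♯∈window xs ys z≤n xs<k)
♯∈window (x ∷ xs) ys {suc s}         (s≤s s≤xs) (s≤s xs<s+k) = ♯∈window xs ys s≤xs xs<s+k

All-¬⇒length≡0 : ∀ {A : Set} {P : A → Set} {xs : List A} → All P xs → (∀ {x} → ¬ P x) → length xs ≡ 0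
All-¬⇒length≡0 []       _  = refl
All-¬⇒length≡0 (px ∷ _) ¬P = ⊥-elim (¬P px)

All-preimage : ∀ {A B : Set} {f : A → B} {P : A → Set} {ys : List B} →
               All (λ y → ∃ λ x → y ≡ f x × P x) ys → ∃ λ xs → ys ≡ map f xs × All P xs
All-preimage []                     = [] , refl , []
All-preimage ((x , refl , px) ∷ ys) with All-preimage ys
... | xs , refl , pxs = x ∷ xs , refl , px ∷ pxs

module _ {X : Set} {R : X → X → Set} (R-asym : ∀ {x y} → R x y → ¬ R y x) where

  private
    R-irrefl : ∀ {x} → ¬ R x x
    R-irrefl r = R-asym r r

    ∈-tail : ∀ {y : X} {ys zs} → All (λ z → z ≢ y) zs → All (_∈ y ∷ ys) zs → All (_∈ ys) zs
    ∈-tail []           []                = []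
    ∈-tail (z≢y ∷ ≢s) (here z≡y ∷ _)    = ⊥-elim (z≢y z≡y)
    ∈-tail (_ ∷ ≢s)   (there z∈ys ∷ ∈s) = z∈ys ∷ ∈-tail ≢s ∈s

  Sorted-∈⇒⊆ : ∀ {xs ys : List X} → AllPairs R xs → AllPairs R ys → All (_∈ ys) xs → xs ⊆ ys
  Sorted-∈⇒⊆ {[]}    {ys}    _ _ _ = []⊆-universal ys
  Sorted-∈⇒⊆ {_ ∷ _} {[]}    _ _ (() ∷ _)
  Sorted-∈⇒⊆ {x ∷ xs} {y ∷ ys} (x<xs ∷ xs↑) (_ ∷ ys↑) (here refl ∷ xs∈) =
    refl ∷ Sorted-∈⇒⊆ xs↑ ys↑ (∈-tail (All.map (λ x<z z≡x → R-irrefl (subst (R x) z≡x x<z)) x<xs) xs∈)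
  Sorted-∈⇒⊆ {x ∷ xs} {y ∷ ys} (x<xs ∷ xs↑) (y<ys ∷ ys↑) (there x∈ys ∷ xs∈) =
    y ∷ʳ Sorted-∈⇒⊆ (x<xs ∷ xs↑) ys↑ (∈-tail (x≢y ∷ All.map z≢y x<xs) (there x∈ys ∷ xs∈))
    where
    y<x : R y x
    y<x = All.lookup y<ys x∈ys
    x≢y : x ≢ y
    x≢y x≡y = R-irrefl (subst (R y) x≡y y<x)
    z≢y : ∀ {z} → R x z → z ≢ y
    z≢y x<z z≡y = R-asym (subst (R x) z≡y x<z) y<x

module _ {X : Set} where

  record Split (a : X) (A : List X) (Ls : List (List X)) : Set where
    field
      kept skipped   : List (List X)
      length-split   : length Ls ≡ length kept + length skipped
      kept-unique    : Unique kept
      skipped-unique : Unique skipped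
      kept-∈         : All (λ S → a ∷ S ∈ Ls) kept
      skipped-∈      : All (λ S → S ∈ Ls × S ⊆ A) skipped

  split : ∀ {a : X} {A Ls} → Unique Ls → All (_⊆ a ∷ A) Ls → Split a A Ls
  split [] [] = record
    { kept = [] ; skipped = [] ; length-split = refl
    ; kept-unique = [] ; skipped-unique = [] ; kept-∈ = [] ; skipped-∈ = [] }
  split {a} (S∉Ls ∷ Ls-unique) (S⊆aA ∷ Ls⊆aA) with split Ls-unique Ls⊆aA | S⊆aA
  ... | r | _∷_ {xs = S} refl _ = record
    { kept = S ∷ kept ; skipped = skipped ; length-split = cong suc length-split
    ; kept-unique    = All.map (λ aT∈Ls S≡T → All.lookup S∉Ls aT∈Ls (cong (a ∷_) S≡T)) kept-∈ ∷ kept-unique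
    ; skipped-unique = skipped-unique
    ; kept-∈    = here refl ∷ All.map there kept-∈
    ; skipped-∈ = All.map (λ (T∈Ls , T⊆A) → there T∈Ls , T⊆A) skipped-∈ }
    where open Split r
  ... | r | _ ∷ʳ S⊆A = record
    { kept = kept ; skipped = _ ∷ skipped
    ; length-split   = trans (cong suc length-split) (sym (+-suc (length kept) (length skipped)))
    ; kept-unique    = kept-unique
    ; skipped-unique = All.map (All.lookup S∉Ls ∘ proj₁) skipped-∈ ∷ skipped-unique
    ; kept-∈    = All.map there kept-∈
    ; skipped-∈ = (here refl , S⊆A) ∷ All.map (λ (T∈Ls , T⊆A) → there T∈Ls , T⊆A) skipped-∈ }
    where open Split r

  Between : List X → List X → ℕ → List X → Set
  Between U A r S = U ⊆ S × S ⊆ A × length S ≡ length U + r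

  ⊆-∷ʳ⁻ : ∀ {a : X} {U S} → a ∉ U → U ⊆ a ∷ S → U ⊆ S
  ⊆-∷ʳ⁻ _   (_ ∷ʳ U⊆S) = U⊆S
  ⊆-∷ʳ⁻ a∉U (refl ∷ _) = ⊥-elim (a∉U (here refl))

  Between-∷⁻ : ∀ {a : X} {U A r S} → Between (a ∷ U) (a ∷ A) r (a ∷ S) → Between U A r S
  Between-∷⁻ (aU⊆aS , aS⊆aA , |aS|≡) = ∷⁻ aU⊆aS , ∷⁻ aS⊆aA , suc-injective |aS|≡

  Between-∷ʳ⁻ : ∀ {a : X} {U A r S} → a ∉ U → Between U (a ∷ A) (suc r) (a ∷ S) → Between U A r S
  Between-∷ʳ⁻ {r = r} a∉U (U⊆aS , aS⊆aA , |aS|≡) =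
    ⊆-∷ʳ⁻ a∉U U⊆aS , ∷⁻ aS⊆aA , suc-injective (trans |aS|≡ (+-suc _ r))

  ¬Between-∷ʳ-zero : ∀ {a : X} {U A S} → a ∉ U → ¬ Between U (a ∷ A) 0 (a ∷ S)
  ¬Between-∷ʳ-zero a∉U (U⊆aS , _ , |aS|≡) =
    <⇒≱ (≤-reflexive (trans |aS|≡ (+-identityʳ _))) (length-mono-≤ (⊆-∷ʳ⁻ a∉U U⊆aS))

  -- Pascal's rule on the head a of A: if a ∈ U every S keeps a, otherwise S may keep or skip it.
  count-between : ∀ {U A : List X} {n r Ls} → Unique A → U ⊆ A → length A ≡ length U + n →
                  Unique Ls → All (Between U A r) Ls → length Ls ≤ n C r
  count-between _ [] refl _                   []                                   = z≤n
  count-between _ [] refl _                   ((_ , [] , refl) ∷ [])               = ≤-refl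
  count-between _ [] refl ((S≢T ∷ _) ∷ _) ((_ , [] , _) ∷ (_ , [] , _) ∷ _) = ⊥-elim (S≢T refl)
  count-between {A = _ ∷ A} {n} {r} {Ls} (a∉A ∷ A-unique) (refl ∷ U⊆A) |aA|≡ Ls-unique Ls-between = begin
    length Ls                    ≡⟨ length-split ⟩
    length kept + length skipped ≡⟨ cong (length kept +_) (All-¬⇒length≡0 skipped-∈ skipped-absent) ⟩
    length kept + 0              ≡⟨ +-identityʳ _ ⟩
    length kept                  ≤⟨ count-between A-unique U⊆A (suc-injective |aA|≡) kept-unique
                                      (All.map (Between-∷⁻ ∘ All.lookup Ls-between) kept-∈) ⟩
    n C r                        ∎
    where
    open ≤-Reasoning
    open Split (split Ls-unique (All.map (proj₁ ∘ proj₂) Ls-between))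
    skipped-absent : ∀ {S} → ¬ (S ∈ Ls × S ⊆ A)
    skipped-absent (S∈Ls , S⊆A) =
      All.lookup a∉A (Any-resp-⊆ (⊆-trans (proj₁ (All.lookup Ls-between S∈Ls)) S⊆A) (here refl)) refl
  count-between {n = zero} _ (_ ∷ʳ U⊆A) |aA|≡ _ _ =
    ⊥-elim (1+n≰n (≤-trans (≤-reflexive (trans |aA|≡ (+-identityʳ _))) (length-mono-≤ U⊆A)))
  count-between {U = U} {A = a ∷ A} {n = suc n} {r} {Ls}
                (a∉A ∷ A-unique) (_ ∷ʳ U⊆A) |aA|≡ Ls-unique Ls-between = begin
    length Ls                    ≡⟨ length-split ⟩
    length kept + length skipped ≤⟨ +-monoʳ-≤ (length kept)
                                      (count-between A-unique U⊆A |A|≡ skipped-unique (All.map skipped-between skipped-∈)) ⟩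
    length kept + n C r          ≤⟨ kept-bound (All.map (All.lookup Ls-between) kept-∈) ⟩
    suc n C r                    ∎
    where
    open ≤-Reasoning
    open Split (split Ls-unique (All.map (proj₁ ∘ proj₂) Ls-between))
    |A|≡ : length A ≡ length U + n
    |A|≡ = suc-injective (trans |aA|≡ (+-suc (length U) n))
    a∉U : a ∉ U
    a∉U a∈U = All.lookup a∉A (Any-resp-⊆ U⊆A a∈U) refl
    skipped-between : ∀ {S} → S ∈ Ls × S ⊆ A → Between U A r S
    skipped-between (S∈Ls , S⊆A) with All.lookup Ls-between S∈Ls
    ... | U⊆S , _ , |S|≡ = U⊆S , S⊆A , |S|≡
    kept-bound : ∀ {r} → All (λ S → Between U (a ∷ A) r (a ∷ S)) kept → length kept + n C r ≤ suc n C r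
    kept-bound {zero}  kept-between = ≤-reflexive (cong (_+ 1) (All-¬⇒length≡0 kept-between (¬Between-∷ʳ-zero a∉U)))
    kept-bound {suc r} kept-between = begin
      length kept + n C suc r ≤⟨ +-monoˡ-≤ (n C suc r) (count-between A-unique U⊆A |A|≡ kept-unique
                                   (All.map (Between-∷ʳ⁻ a∉U) kept-between)) ⟩
      n C r + n C suc r       ≡⟨ nCk+nC[k+1]≡[n+1]C[k+1] n r ⟩
      suc n C suc r           ∎

nCk≤[d+n]C[d+k] : ∀ d n k → n C k ≤ (d + n) C (d + k)
nCk≤[d+n]C[d+k] zero    n k = ≤-refl
nCk≤[d+n]C[d+k] (suc d) n k = begin
  n C k                                         ≤⟨ nCk≤[d+n]C[d+k] d n k ⟩
  (d + n) C (d + k)                             ≤⟨ m≤m+n _ _ ⟩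
  (d + n) C (d + k) + (d + n) C suc (d + k)     ≡⟨ nCk+nC[k+1]≡[n+1]C[k+1] (d + n) (d + k) ⟩
  suc (d + n) C suc (d + k)                     ∎
  where open ≤-Reasoning

nCk≤[l+n∸t]C[l+k∸t] : ∀ {t l} n k → t ≤ l → n C k ≤ (l + n ∸ t) C (l + k ∸ t)
nCk≤[l+n∸t]C[l+k∸t] {t} {l} n k t≤l = begin
  n C k                             ≤⟨ nCk≤[d+n]C[d+k] (l ∸ t) n k ⟩
  (l ∸ t + n) C (l ∸ t + k)         ≡⟨ cong₂ _C_ (+-∸-comm n t≤l) (+-∸-comm k t≤l) ⟨
  (l + n ∸ t) C (l + k ∸ t)         ∎
  where open ≤-Reasoning

injective-into⇒≤^ : ∀ {X : Set} {β n} {U : List X} (P : Fin β → Vec X n) → Injective _≡_ _≡_ P →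
                    (∀ j i → Vec.lookup (P j) i ∈ U) → β ≤ length U ^ n
injective-into⇒≤^ {β = β} {n} {U} P P-injective P∈U = injective⇒≤ code-injective
  where
  code : Fin β → Fin (length U ^ n)
  code j = funToFin (λ i → index (P∈U j i))

  code-injective : Injective _≡_ _≡_ code
  code-injective {j} {j′} code≡ = P-injective (Pointwise-≡⇒≡ (ext λ i → begin
    Vec.lookup (P j) i                 ≡⟨ lookup-index (P∈U j i) ⟩
    List.lookup U (index (P∈U j i))    ≡⟨ cong (List.lookup U) (index≡ i) ⟩
    List.lookup U (index (P∈U j′ i))   ≡⟨ lookup-index (P∈U j′ i) ⟨
    Vec.lookup (P j′) i                ∎))
    where
    open ≡-Reasoning
    index≡ : ∀ i → index (P∈U j i) ≡ index (P∈U j′ i)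
    index≡ i = trans (sym (finToFun-funToFin _ i)) (trans (cong (λ c → finToFun c i) code≡) (finToFun-funToFin _ i))

LexLt-asym : ∀ {n} {x y : Vec Bool n} → LexLt x y → ¬ LexLt y x
LexLt-asym here ()
LexLt-asym (there x<y) (there y<x) = LexLt-asym x<y y<x

LexLt-irrefl : ∀ {n} {x : Vec Bool n} → ¬ LexLt x x
LexLt-irrefl x<x = LexLt-asym x<x x<x

LexLt-trans : ∀ {n} {x y z : Vec Bool n} → LexLt x y → LexLt y z → LexLt x z
LexLt-trans here      (there _)   = here
LexLt-trans (there _) here        = here
LexLt-trans (there p) (there q)   = there (LexLt-trans p q)

Increasing⇒Linked : ∀ {p k} (ws : Vec (Vec Bool p) k) → Increasing ws → Linked LexLt (Vec.toList ws)
Increasing⇒Linked Vec.[]                 _   = []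
Increasing⇒Linked (_ Vec.∷ Vec.[])       _   = [-]
Increasing⇒Linked (_ Vec.∷ w Vec.∷ ws) inc = inc Fin.zero ∷ Increasing⇒Linked (w Vec.∷ ws) (inc ∘ Fin.suc)

Increasing⇒Sorted : ∀ {p k} (ws : Vec (Vec Bool p) k) → Increasing ws → AllPairs LexLt (Vec.toList ws)
Increasing⇒Sorted ws inc = Linked⇒AllPairs LexLt-trans (Increasing⇒Linked ws inc)

allWords : ∀ p → List (Vec Bool p)
allWords zero    = Vec.[] ∷ []
allWords (suc p) = map (false Vec.∷_) (allWords p) ++ map (true Vec.∷_) (allWords p)

∈-allWords : ∀ {p} (w : Vec Bool p) → w ∈ allWords p
∈-allWords Vec.[]              = here refl
∈-allWords (false Vec.∷ w)     = ∈-++⁺ˡ (∈-map⁺ (false Vec.∷_) (∈-allWords w))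
∈-allWords {suc p} (true Vec.∷ w) = ∈-++⁺ʳ (map (false Vec.∷_) (allWords p)) (∈-map⁺ (true Vec.∷_) (∈-allWords w))

length-allWords : ∀ p → length (allWords p) ≡ 2 ^ p
length-allWords zero    = refl
length-allWords (suc p) = begin
  length (map (false Vec.∷_) (allWords p) ++ map (true Vec.∷_) (allWords p))
    ≡⟨ length-++ (map (false Vec.∷_) (allWords p)) ⟩
  length (map (false Vec.∷_) (allWords p)) + length (map (true Vec.∷_) (allWords p))
    ≡⟨ cong₂ _+_ (length-map _ (allWords p)) (length-map _ (allWords p)) ⟩
  length (allWords p) + length (allWords p)
    ≡⟨ cong (λ n → n + n) (length-allWords p) ⟩
  2 ^ p + 2 ^ p
    ≡⟨ cong (2 ^ p +_) (+-identityʳ (2 ^ p)) ⟨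
  2 ^ suc p ∎
  where open ≡-Reasoning

allWords-sorted : ∀ p → AllPairs LexLt (allWords p)
allWords-sorted zero    = [] ∷ []
allWords-sorted (suc p) = AllPairs.++⁺ (prefixed (allWords-sorted p)) (prefixed (allWords-sorted p))
  (allMap (λ _ → allMap (λ _ → here) (allWords p)) (allWords p))
  where
  prefixed : ∀ {b} {ws : List (Vec Bool p)} → AllPairs LexLt ws → AllPairs LexLt (map (b Vec.∷_) ws)
  prefixed ws↑ = AllPairs.map⁺ (AllPairs.map there ws↑)
  allMap : ∀ {b} {P : Vec Bool (suc p) → Set} → (∀ w → P (b Vec.∷ w)) → ∀ ws → All P (map (b Vec.∷_) ws)
  allMap f ws = All.map⁺ (All.universal f ws)

allWords-unique : ∀ p → Unique (allWords p)
allWords-unique p = AllPairs.map (λ v<w v≡w → LexLt-irrefl (subst (LexLt _) (sym v≡w) v<w)) (allWords-sorted p)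

encodeList : ∀ {p} → List (Vec Bool p) → List Sym
encodeList = concatMap (λ w → ♯ ∷ word w)

bit-injective : ∀ {a b} → bit a ≡ bit b → a ≡ b
bit-injective {false} {false} _ = refl
bit-injective {true}  {true}  _ = refl

♯≢bit : ∀ b → ♯ ≢ bit b
♯≢bit false ()
♯≢bit true  ()

length-word : ∀ {p} (w : Vec Bool p) → length (word w) ≡ p
length-word w = trans (length-map bit (Vec.toList w)) (length-toList w)

word-injective : ∀ {p} {v w : Vec Bool p} → word v ≡ word w → v ≡ w
word-injective {v = Vec.[]}    {Vec.[]}    _  = refl
word-injective {v = _ Vec.∷ _} {_ Vec.∷ _} eq with ∷-injective eq
... | a≡b , v≡w = cong₂ Vec._∷_ (bit-injective a≡b) (word-injective v≡w)

♯∉word : ∀ {p} (w : Vec Bool p) → ♯ ∉ word w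
♯∉word w ♯∈w with ∈-map⁻ bit ♯∈w
... | b , _ , ♯≡b = ♯≢bit b ♯≡b

take-word-++ : ∀ {p} (w : Vec Bool p) xs → take p (word w ++ xs) ≡ word w
take-word-++ w xs = subst (λ k → take k (word w ++ xs) ≡ word w) (length-word w) (take-length-++ (word w) xs)

drop-word-++ : ∀ {p} (w : Vec Bool p) xs k → drop (p + k) (word w ++ xs) ≡ drop k xs
drop-word-++ w xs k = subst (λ l → drop (l + k) (word w ++ xs) ≡ drop k xs) (length-word w) (drop-length-++ (word w) xs k)

module _ {n : ℕ} where

  -- A word-length window starting strictly inside w contains the ♯ opening the next word, or runs
  -- past the end of the text.
  no-straddle : ∀ (w : Vec Bool (suc n)) (ws : List (Vec Bool (suc n))) {s} {v : Vec Bool (suc n)} → s < n →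
                take (suc n) (drop (suc s) (word w ++ encodeList ws)) ≢ word v
  no-straddle w [] {s} {v} s<n window≡v = 1+n≰n (begin
    suc n                                       ≡⟨ length-word v ⟨
    length (word v)                             ≡⟨ cong length window≡v ⟨
    length (take (suc n) (drop (suc s) (word w ++ []))) ≤⟨ length-window (word w ++ []) (suc s) (suc n) ⟩
    length (word w ++ []) ∸ suc s               ≡⟨ cong (λ xs → length xs ∸ suc s) (++-identityʳ (word w)) ⟩
    length (word w) ∸ suc s                     ≡⟨ cong (_∸ suc s) (length-word w) ⟩
    n ∸ s                                       ≤⟨ m∸n≤m n s ⟩
    n                                           ∎)
    where open ≤-Reasoning
  no-straddle w (_ ∷ _) {s} {v} s<n window≡v =
    ♯∉word v (subst (♯ ∈_) window≡v (♯∈window (word w) _ starts-inside ends-outside))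
    where
    starts-inside : suc s ≤ length (word w)
    starts-inside = subst (suc s ≤_) (sym (length-word w)) (m≤n⇒m≤1+n s<n)
    ends-outside : length (word w) < suc s + suc n
    ends-outside = subst (_< suc s + suc n) (sym (length-word w)) (m<n+m (suc n) z<s)

  window⇒∈ : ∀ (ws : List (Vec Bool (suc n))) s {v} → take (suc n) (drop s (encodeList ws)) ≡ word v → v ∈ ws
  window⇒∈ []       zero    {_ Vec.∷ _} ()
  window⇒∈ []       (suc _) {_ Vec.∷ _} ()
  window⇒∈ (w ∷ ws) zero    {b Vec.∷ _} window≡v = ⊥-elim (♯≢bit b (∷-injectiveˡ window≡v))
  window⇒∈ (w ∷ ws) (suc zero) window≡v =
    here (word-injective (trans (sym window≡v) (take-word-++ w (encodeList ws))))
  window⇒∈ (w ∷ ws) (suc (suc s)) window≡v with suc n ≤? suc s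
  ... | no  1+n≰1+s = ⊥-elim (no-straddle w ws (≤-pred (≰⇒> 1+n≰1+s)) window≡v)
  ... | yes 1+n≤1+s with m≤n⇒∃[o]m+o≡n 1+n≤1+s
  ...   | o , refl =
    there (window⇒∈ ws o (trans (cong (take (suc n)) (sym (drop-word-++ w (encodeList ws) o))) window≡v))

  occurs⇒∈ : ∀ (ws : List (Vec Bool (suc n))) {v s} → OccursAt (word v) (encodeList ws) s → v ∈ ws
  occurs⇒∈ ws {v} {s} (_ , window≡v) =
    window⇒∈ ws s (subst (λ k → take k (drop s (encodeList ws)) ≡ word v) (length-word v) window≡v)

  MatchesBin⇒∈ : ∀ {κ γ} {P : BinPattern κ (suc n)} (ws : List (Vec Bool (suc n))) →
                 MatchesBin γ P (encodeList ws) → ∀ i → Vec.lookup P i ∈ ws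
  MatchesBin⇒∈ {P = P} ws (pos , occurs , _) i =
    occurs⇒∈ ws (subst (λ x → OccursAt x (encodeList ws) (pos i)) (lookup-map i word P) (occurs i))

module _ {κ n β : ℕ} (P : Fin β → BinPattern κ (suc n)) where

  InPattern : Vec Bool (suc n) → Set
  InPattern w = ∃₂ λ j i → Vec.lookup (P j) i ≡ w

  inPattern? : ∀ w → Dec (InPattern w)
  inPattern? w = any? λ j → any? λ i → ≡-dec _≟ᵇ_ (Vec.lookup (P j) i) w

  patternWords : List (Vec Bool (suc n))
  patternWords = filter inPattern? (allWords (suc n))

  patternWords-⊆ : patternWords ⊆ allWords (suc n)
  patternWords-⊆ = filter-⊆ inPattern? (allWords (suc n))

  lookup∈patternWords : ∀ j i → Vec.lookup (P j) i ∈ patternWords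
  lookup∈patternWords j i = ∈-filter⁺ inPattern? (∈-allWords _) (j , i , refl)

  matchingText⇒words : ∀ {γ m txt} → InQ (suc n) m txt → (∀ j → MatchesBin γ (P j) txt) →
                       ∃ λ S → txt ≡ encodeList S × (patternWords ⊆ S × S ⊆ allWords (suc n) × length S ≡ m)
  matchingText⇒words (ws , ws↑ , refl) matches =
    Vec.toList ws , refl , patternWords⊆ws , ws⊆allWords , length-toList ws
    where
    ws-sorted : AllPairs LexLt (Vec.toList ws)
    ws-sorted = Increasing⇒Sorted ws ws↑
    ∈ws : ∀ {w} → w ∈ patternWords → w ∈ Vec.toList ws
    ∈ws w∈ with ∈-filter⁻ inPattern? {xs = allWords (suc n)} w∈
    ... | _ , j , i , refl = MatchesBin⇒∈ {P = P j} (Vec.toList ws) (matches j) i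
    patternWords⊆ws : patternWords ⊆ Vec.toList ws
    patternWords⊆ws =
      Sorted-∈⇒⊆ LexLt-asym (AllPairs.filter⁺ inPattern? (allWords-sorted (suc n))) ws-sorted (All.tabulate ∈ws)
    ws⊆allWords : Vec.toList ws ⊆ allWords (suc n)
    ws⊆allWords = Sorted-∈⇒⊆ LexLt-asym ws-sorted (allWords-sorted (suc n)) (All.universal ∈-allWords _)

lemma2 : (κ p γ D m β t : ℕ) → 1 ≤ κ → 1 ≤ p → 1 ≤ γ →
    D ≡ m * suc p → m ≤ 2 ^ p →
    β ≤ t ^ suc κ → ((s : ℕ) → s < t → s ^ suc κ < β) →
    (P : Fin β → BinPattern κ p) → Injective _≡_ _≡_ P →
    ((j : Fin β) → Increasing (P j)) →
    (L : List (List Sym)) → Unique L →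
    All (λ txt → InQ p m txt × ((j : Fin β) → MatchesBin γ (P j) txt)) L →
    length L ≤ (2 ^ p ∸ t) C (m ∸ t)
-- Besides 1 ≤ p, only the minimality of t is used among the numeric hypotheses.
lemma2 _ zero    _ _ _ _ _ _ () _ _ _ _ _ _ _ _ _ _ _
lemma2 κ (suc p) _ _ m β t _ _ _ _ _ _ t-minimal P P-injective _ L L-unique L-texts
  with All-preimage (All.map (λ (inQ , matches) → matchingText⇒words P inQ matches) L-texts)
... | [] , refl , _ = z≤n
... | Ls@(_ ∷ _) , refl , Ls-valid@((U⊆S , _ , |S|≡m) ∷ _) = begin
  length (map encodeList Ls)     ≡⟨ length-map encodeList Ls ⟩
  length Ls                      ≤⟨ count-between (allWords-unique (suc p)) (patternWords-⊆ P) |allWords|≡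
                                      (Unique.map⁻ L-unique) (All.map between Ls-valid) ⟩
  (N ∸ k) C (m ∸ k)              ≤⟨ nCk≤[l+n∸t]C[l+k∸t] (N ∸ k) (m ∸ k) t≤k ⟩
  (k + (N ∸ k) ∸ t) C (k + (m ∸ k) ∸ t)
                                 ≡⟨ cong₂ (λ N′ m′ → (N′ ∸ t) C (m′ ∸ t)) (m+[n∸m]≡n k≤N) (m+[n∸m]≡n k≤m) ⟩
  (N ∸ t) C (m ∸ t)              ∎
  where
  open ≤-Reasoning
  N k : ℕ
  N = 2 ^ suc p
  k = length (patternWords P)
  k≤N : k ≤ N
  k≤N = subst (k ≤_) (length-allWords (suc p)) (length-mono-≤ (patternWords-⊆ P))
  k≤m : k ≤ m
  k≤m = subst (k ≤_) |S|≡m (length-mono-≤ U⊆S)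
  |allWords|≡ : length (allWords (suc p)) ≡ k + (N ∸ k)
  |allWords|≡ = trans (length-allWords (suc p)) (sym (m+[n∸m]≡n k≤N))
  between : ∀ {T} → patternWords P ⊆ T × T ⊆ allWords (suc p) × length T ≡ m →
            Between (patternWords P) (allWords (suc p)) (m ∸ k) T
  between (U⊆T , T⊆A , |T|≡m) = U⊆T , T⊆A , trans |T|≡m (sym (m+[n∸m]≡n k≤m))
  t≤k : t ≤ k
  t≤k = ≮⇒≥ λ k<t → <⇒≱ (t-minimal k k<t) (injective-into⇒≤^ P P-injective (lookup∈patternWords P))
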